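{- Let $m,t\in\mathbb N$, $\alpha>0$, and let $(p_i,q_i)_{i\in I}$ be a family of elements of $\mathbb N^2$ such that (a) $(1-\alpha)\sum_{i\in I}p_i\le\sum_{i\in I}q_i\le(1+\alpha)\sum_{i\in I}p_i$; (b) $p_i+q_i\le\alpha m$ for all $i\in I$; (c) $\max\{\sum_{i\in I}p_i,\sum_{i\in I}q_i\}<(1-10\alpha)mt$. Then there is a partition $\mathcal J$ of $I$ into $t$ sets such that for every $J\in\mathcal J$, $\sum_{j\in J}p_j\le(1-7\alpha)m$ and $\sum_{j\in J}q_j\le(1-7\alpha)m$.
   Formalization: The parameter α ranges over the positive rationals. -}

module Defs where

open import Data.Nat using (ℕ; zero; suc)
import Data.Nat as ℕ
open import Data.Fin using (Fin; zero; suc; _≟_)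
open import Data.Integer using (+_)
open import Data.Rational using (ℚ; _/_)
open import Relation.Nullary using (yes; no)

ℕ→ℚ : ℕ → ℚ
ℕ→ℚ n = (+ n) / 1

sumFin : ∀ {n} → (Fin n → ℕ) → ℕ
sumFin {zero}  f = 0
sumFin {suc n} f = f zero ℕ.+ sumFin (λ i → f (suc i))

-- Σ_{i ∈ J} f i where J = part j of the partition given by the
-- assignment π : Fin n → Fin t, i.e. J = { i | π i ≡ j }
partSum : ∀ {n t} → (Fin n → Fin t) → Fin t → (Fin n → ℕ) → ℕ
partSum π j f = sumFin (λ i → helper (π i ≟ j) (f i))
  where
    helper : ∀ {A : Set} → Relation.Nullary.Dec A → ℕ → ℕ
    helper (yes _) x = x
    helper (no _)  _ = 0

{-# OPTIONS --safe #-}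
module Submission where

-- Write α = a/b and clear denominators: the weights x_i = b p_i and y_i = b q_i are
-- at most s = a m, both totals are below D t for D = (b − 9a) m, and the required bin capacity
-- (1 − 7α) m becomes C = (b − 7a) m = D + 2s.  The bins are filled one after another by a greedy
-- procedure that always adds an item which is at least as heavy in the coordinate in which the
-- current bin is lighter, so that the two loads X, Y of the bin differ by at most s as long as
-- items of the required kind remain.  A bin is closed as soon as one load reaches D + s; its
-- other load is then at least D as well, unless every remaining item is heavier in the first
-- coordinate, in which case the remaining total of the second coordinate is at most that of the
-- first.  Either way both remaining totals drop below D (t − 1), and induction on t finishes.

open import Defs
open import Data.Nat using (ℕ)
open import Data.Fin using (Fin)
open import Data.Product using (Σ; _×_)

module BinPacking where

  open import Data.Nat hiding (_≟_)
  open import Data.Nat.Properties hiding (_≟_)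
  open import Data.Nat.Induction using (<-wellFounded)
  open import Data.Nat.Tactic.RingSolver using (solve-∀)
  open import Data.Fin using (Fin; zero; suc; _≟_)
  open import Data.Fin.Properties as Fin using (any?)
  open import Data.Bool using (Bool; true; false; T; not; _∧_; _∨_; if_then_else_)
  open import Data.Bool.Properties using (T?)
  open import Data.Empty using (⊥-elim)
  open import Data.Product using (Σ-syntax; _×_; _,_; proj₁; proj₂; swap; map₂)
  open import Data.Sum using (_⊎_; inj₁; inj₂)
  open import Function using (_∘_)
  open import Induction.WellFounded using (Acc; acc)
  open import Relation.Nullary using (¬_; Dec; does; yes; no)
  open import Relation.Nullary.Decidable using (_×-dec_; _⊎-dec_)
  open import Relation.Binary.PropositionalEquality
  open import Algebra.Properties.CommutativeSemigroup +-commutativeSemigroup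
    using (interchange; xy∙z≈zy∙x; xy∙z≈xz∙y)

  sumFin-cong : ∀ {n} {f g : Fin n → ℕ} → (∀ i → f i ≡ g i) → sumFin f ≡ sumFin g
  sumFin-cong {zero}  f≗g = refl
  sumFin-cong {suc n} f≗g = cong₂ _+_ (f≗g zero) (sumFin-cong (λ i → f≗g (suc i)))

  sumFin-mono : ∀ {n} {f g : Fin n → ℕ} → (∀ i → f i ≤ g i) → sumFin f ≤ sumFin g
  sumFin-mono {zero}  f≤g = z≤n
  sumFin-mono {suc n} f≤g = +-mono-≤ (f≤g zero) (sumFin-mono (λ i → f≤g (suc i)))

  sumFin-+ : ∀ {n} (f g : Fin n → ℕ) → sumFin (λ i → f i + g i) ≡ sumFin f + sumFin g
  sumFin-+ {zero}  f g = refl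
  sumFin-+ {suc n} f g =
    trans (cong (f zero + g zero +_) (sumFin-+ (λ i → f (suc i)) (λ i → g (suc i))))
          (interchange (f zero) (g zero) _ _)

  sumFin-* : ∀ {n} (c : ℕ) (f : Fin n → ℕ) → sumFin (λ i → c * f i) ≡ c * sumFin f
  sumFin-* {zero}  c f = sym (*-zeroʳ c)
  sumFin-* {suc n} c f =
    trans (cong (c * f zero +_) (sumFin-* c (λ i → f (suc i)))) (sym (*-distribˡ-+ c (f zero) _))

  sumFin-differ-at : ∀ {n} (i : Fin n) {f g : Fin n → ℕ} → (∀ j → j ≢ i → f j ≡ g j) →
                     sumFin f + g i ≡ sumFin g + f i
  sumFin-differ-at zero    {f} {g} f≗g =
    trans (cong (λ u → f zero + u + g zero) (sumFin-cong (λ j → f≗g (suc j) λ ())))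
          (xy∙z≈zy∙x (f zero) _ (g zero))
  sumFin-differ-at (suc i) {f} {g} f≗g = begin
    f zero + F + g (suc i)    ≡⟨ +-assoc (f zero) F _ ⟩
    f zero + (F + g (suc i))  ≡⟨ cong₂ _+_ (f≗g zero λ ()) (sumFin-differ-at i f≗g∘suc) ⟩
    g zero + (G + f (suc i))  ≡⟨ +-assoc (g zero) G _ ⟨
    g zero + G + f (suc i)    ∎
    where
    open ≡-Reasoning
    F G : ℕ
    F = sumFin (λ j → f (suc j))
    G = sumFin (λ j → g (suc j))
    f≗g∘suc : ∀ j → j ≢ i → f (suc j) ≡ g (suc j)
    f≗g∘suc j j≢i = f≗g (suc j) (j≢i ∘ Fin.suc-injective)

  Mask : ℕ → Set
  Mask n = Fin n → Bool

  module _ {n : ℕ} where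

    infix  4 _⊆_
    infixl 7 _∩_ _∖_
    infix  10 ∑⟨_⟩_

    _⊆_ : Mask n → Mask n → Set
    A ⊆ B = ∀ {i} → T (A i) → T (B i)

    ∅ : Mask n
    ∅ _ = false

    _∩_ _∖_ : Mask n → Mask n → Mask n
    (A ∩ B) i = A i ∧ B i
    (A ∖ B) i = A i ∧ not (B i)

    insert : Fin n → Mask n → Mask n
    insert i B j = does (j ≟ i) ∨ B j

    preimage : ∀ {t} → (Fin n → Fin t) → Fin t → Mask n
    preimage σ k i = does (σ i ≟ k)

    ∑⟨_⟩_ : Mask n → (Fin n → ℕ) → ℕ
    ∑⟨ A ⟩ f = sumFin (λ i → if A i then f i else 0)

    ∣_∣ : Mask n → ℕ
    ∣ A ∣ = ∑⟨ A ⟩ (λ _ → 1)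

    ∈∖ : ∀ A B {i} → T ((A ∖ B) i) → T (A i) × ¬ T (B i)
    ∈∖ A B {i} i∈A∖B with A i | B i
    ... | true  | false = _ , λ ()
    ... | true  | true  = ⊥-elim i∈A∖B
    ... | false | _     = ⊥-elim i∈A∖B

    ∩-⊆ˡ : ∀ A B → A ∩ B ⊆ A
    ∩-⊆ˡ A B {i} with A i
    ... | true  = _
    ... | false = λ ()

    ∖-empty⇒⊆ : ∀ A B → (∀ i → ¬ T ((A ∖ B) i)) → A ⊆ B
    ∖-empty⇒⊆ A B A∖B-empty {i} with A i | B i | A∖B-empty i
    ... | _     | true  | _    = _
    ... | false | false | _    = λ ()
    ... | true  | false | ∉A∖B = λ _ → ∉A∖B _

    insert-⊆ : ∀ i B {M} → T (M i) → B ⊆ M → insert i B ⊆ M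
    insert-⊆ i B i∈M B⊆M {j} with j ≟ i
    ... | yes refl = λ _ → i∈M
    ... | no  _    = B⊆M

    ∖-insert-⊆ : ∀ i M B → M ∖ insert i B ⊆ M ∖ B
    ∖-insert-⊆ i M B {j} with j ≟ i | M j | B j
    ... | yes _ | true  | false = _
    ... | no  _ | true  | false = _
    ... | yes _ | false | _     = λ ()
    ... | no  _ | false | _     = λ ()
    ... | yes _ | true  | true  = λ ()
    ... | no  _ | true  | true  = λ ()

    ∑-∅ : ∀ f → ∑⟨ ∅ ⟩ f ≡ 0
    ∑-∅ f = sumFin-zero n
      where
      sumFin-zero : ∀ m → sumFin {m} (λ _ → 0) ≡ 0
      sumFin-zero zero    = refl
      sumFin-zero (suc m) = sumFin-zero m

    ∑-mono-⊆ : ∀ {A B} → A ⊆ B → ∀ f → ∑⟨ A ⟩ f ≤ ∑⟨ B ⟩ f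
    ∑-mono-⊆ {A} {B} A⊆B f = sumFin-mono pointwise
      where
      pointwise : ∀ i → (if A i then f i else 0) ≤ (if B i then f i else 0)
      pointwise i with A i | B i | A⊆B {i}
      ... | false | _     | _   = z≤n
      ... | true  | true  | _   = ≤-refl
      ... | true  | false | A→B = ⊥-elim (A→B _)

    ∑-mono-≤ : ∀ A {f g} → (∀ {i} → T (A i) → f i ≤ g i) → ∑⟨ A ⟩ f ≤ ∑⟨ A ⟩ g
    ∑-mono-≤ A {f} {g} f≤g = sumFin-mono pointwise
      where
      pointwise : ∀ i → (if A i then f i else 0) ≤ (if A i then g i else 0)
      pointwise i with A i | f≤g {i}
      ... | false | _    = z≤n
      ... | true  | fi≤gi = fi≤gi _

    ∑-* : ∀ A c f → ∑⟨ A ⟩ (λ i → c * f i) ≡ c * ∑⟨ A ⟩ f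
    ∑-* A c f = trans (sumFin-cong pointwise) (sumFin-* c (λ i → if A i then f i else 0))
      where
      pointwise : ∀ i → (if A i then c * f i else 0) ≡ c * (if A i then f i else 0)
      pointwise i with A i
      ... | false = sym (*-zeroʳ c)
      ... | true  = refl

    ∑-split : ∀ {B M} → B ⊆ M → ∀ f → ∑⟨ M ⟩ f ≡ ∑⟨ B ⟩ f + ∑⟨ M ∖ B ⟩ f
    ∑-split {B} {M} B⊆M f =
      trans (sumFin-cong pointwise)
            (sumFin-+ (λ i → if B i then f i else 0) (λ i → if (M ∖ B) i then f i else 0))
      where
      pointwise : ∀ i → (if M i then f i else 0)
                        ≡ (if B i then f i else 0) + (if (M ∖ B) i then f i else 0)
      pointwise i with B i | M i | B⊆M {i}
      ... | false | false | _   = refl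
      ... | false | true  | _   = refl
      ... | true  | true  | _   = sym (+-identityʳ (f i))
      ... | true  | false | B→M = ⊥-elim (B→M _)

    ∑-insert : ∀ i B → ¬ T (B i) → ∀ f → ∑⟨ insert i B ⟩ f ≡ ∑⟨ B ⟩ f + f i
    ∑-insert i B i∉B f = begin
      ∑⟨ insert i B ⟩ f                             ≡⟨ +-identityʳ _ ⟨
      ∑⟨ insert i B ⟩ f + 0                         ≡⟨ cong (∑⟨ insert i B ⟩ f +_) (unselected (B i) i∉B) ⟨
      ∑⟨ insert i B ⟩ f + (if B i then f i else 0)  ≡⟨ sumFin-differ-at i unchanged ⟩
      ∑⟨ B ⟩ f + (if insert i B i then f i else 0)  ≡⟨ cong (∑⟨ B ⟩ f +_) selected ⟩
      ∑⟨ B ⟩ f + f i                                ∎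
      where
      open ≡-Reasoning
      unselected : ∀ b → ¬ T b → (if b then f i else 0) ≡ 0
      unselected false _   = refl
      unselected true  b∉T = ⊥-elim (b∉T _)
      selected : (if insert i B i then f i else 0) ≡ f i
      selected with i ≟ i
      ... | yes _   = refl
      ... | no  i≢i = ⊥-elim (i≢i refl)
      unchanged : ∀ j → j ≢ i → (if insert i B j then f j else 0) ≡ (if B j then f j else 0)
      unchanged j j≢i with j ≟ i
      ... | yes j≡i = ⊥-elim (j≢i j≡i)
      ... | no  _   = refl

    ∑-∖-insert : ∀ i B {M} → B ⊆ M → T (M i) → ¬ T (B i) → ∀ f →
                 ∑⟨ M ∖ B ⟩ f ≡ f i + ∑⟨ M ∖ insert i B ⟩ f
    ∑-∖-insert i B {M} B⊆M i∈M i∉B f = +-cancelˡ-≡ (∑⟨ B ⟩ f) _ _ (begin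
      ∑⟨ B ⟩ f + ∑⟨ M ∖ B ⟩ f                    ≡⟨ ∑-split B⊆M f ⟨
      ∑⟨ M ⟩ f                                  ≡⟨ ∑-split (insert-⊆ i B i∈M B⊆M) f ⟩
      ∑⟨ insert i B ⟩ f + ∑⟨ M ∖ insert i B ⟩ f  ≡⟨ cong (_+ ∑⟨ M ∖ insert i B ⟩ f) (∑-insert i B i∉B f) ⟩
      ∑⟨ B ⟩ f + f i + ∑⟨ M ∖ insert i B ⟩ f     ≡⟨ +-assoc (∑⟨ B ⟩ f) (f i) _ ⟩
      ∑⟨ B ⟩ f + (f i + ∑⟨ M ∖ insert i B ⟩ f)   ∎)
      where open ≡-Reasoning

  partSum-∑ : ∀ {n t} (π : Fin n → Fin t) k f → partSum π k f ≡ ∑⟨ preimage π k ⟩ f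
  partSum-∑ {zero}  π k f = refl
  partSum-∑ {suc n} π k f with π zero ≟ k
  ... | yes _ = cong (f zero +_) (partSum-∑ (λ i → π (suc i)) k (λ i → f (suc i)))
  ... | no  _ = partSum-∑ (λ i → π (suc i)) k (λ i → f (suc i))

  Heavy : ∀ {n} → (x y : Fin n → ℕ) → Mask n → Set
  Heavy {n} x y R = Σ[ i ∈ Fin n ] T (R i) × y i ≤ x i

  heavy? : ∀ {n} (x y : Fin n → ℕ) R → Dec (Heavy x y R)
  heavy? x y R = any? (λ i → T? (R i) ×-dec (y i ≤? x i))

  light : ∀ {n} {x y : Fin n → ℕ} {R} → ¬ Heavy x y R → ∀ {i} → T (R i) → x i ≤ y i
  light ¬heavy {i} i∈R = <⇒≤ (≰⇒> (λ yi≤xi → ¬heavy (i , i∈R , yi≤xi)))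

  remaining-budget : ∀ {D b c r} → D ≤ b → b + c < D * suc r → c < D * r
  remaining-budget {D} {b} {c} {r} D≤b b+c<D[1+r] = +-cancelˡ-< D c (D * r)
    (≤-<-trans (+-monoˡ-≤ c D≤b) (subst (b + c <_) (*-suc D r) b+c<D[1+r]))

  module Balance {n : ℕ} (s D : ℕ) (x y : Fin n → ℕ) where

    Balanced : Mask n → ℕ → ℕ → Set
    Balanced R bx by = (Heavy x y R → by ≤ bx + s) × (Heavy y x R → bx ≤ by + s)

    heavy-mono : ∀ {R′ R} → R′ ⊆ R → Heavy x y R′ → Heavy x y R
    heavy-mono R′⊆R (i , i∈R′ , yi≤xi) = i , R′⊆R i∈R′ , yi≤xi

    extend-lighter : (∀ i → x i ≤ s) → ∀ {R bx by} → bx ≤ by → Balanced R bx by →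
                     (i₀ : Fin n) → T (R i₀) →
                     Σ[ i ∈ Fin n ] T (R i) × (∀ {R′} → R′ ⊆ R → Balanced R′ (bx + x i) (by + y i))
    extend-lighter x≤s {R} {bx} {by} bx≤by (bal-x , _) i₀ i₀∈R with heavy? x y R
    ... | yes (i , i∈R , yi≤xi) = i , i∈R , λ _ →
            (λ _ → ≤-trans (+-mono-≤ (bal-x (i , i∈R , yi≤xi)) yi≤xi)
                           (≤-reflexive (xy∙z≈xz∙y bx s (x i))))
          , (λ _ → ≤-trans (+-mono-≤ bx≤by (x≤s i)) (+-monoˡ-≤ s (m≤m+n by (y i))))
    ... | no ¬heavy = i₀ , i₀∈R , λ R′⊆R →
            (λ heavy → ⊥-elim (¬heavy (heavy-mono R′⊆R heavy)))
          , (λ _ → ≤-trans (+-mono-≤ bx≤by (light ¬heavy i₀∈R)) (m≤m+n (by + y i₀) s))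

    closing-drains : ∀ {R bx by r} → Balanced R bx by → D + s ≤ bx →
                     bx + ∑⟨ R ⟩ x < D * suc r → by + ∑⟨ R ⟩ y < D * suc r →
                     ∑⟨ R ⟩ x < D * r × ∑⟨ R ⟩ y < D * r
    closing-drains {R} {bx} {by} {r} (_ , bal-y) D+s≤bx hx hy = rest-x , rest-y
      where
      rest-x : ∑⟨ R ⟩ x < D * r
      rest-x = remaining-budget (≤-trans (m≤m+n D s) D+s≤bx) hx
      rest-y : ∑⟨ R ⟩ y < D * r
      rest-y with heavy? y x R
      ... | yes heavy = remaining-budget (+-cancelʳ-≤ s D by (≤-trans D+s≤bx (bal-y heavy))) hy
      ... | no ¬heavy = ≤-<-trans (∑-mono-≤ R (light ¬heavy)) rest-x

  module Greedy {n : ℕ} (s D : ℕ) (x y : Fin n → ℕ)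
                (x≤s : ∀ i → x i ≤ s) (y≤s : ∀ i → y i ≤ s) where

    open Balance s D x y
    private module Sym = Balance s D y x

    C : ℕ
    C = D + s + s

    Fits : Mask n → Set
    Fits A = ∑⟨ A ⟩ x ≤ C × ∑⟨ A ⟩ y ≤ C

    fits-⊆ : ∀ {A A′} → A ⊆ A′ → Fits A′ → Fits A
    fits-⊆ A⊆A′ (fx , fy) = ≤-trans (∑-mono-⊆ A⊆A′ x) fx , ≤-trans (∑-mono-⊆ A⊆A′ y) fy

    extend : ∀ {R bx by} → Balanced R bx by → (i₀ : Fin n) → T (R i₀) →
             Σ[ i ∈ Fin n ] T (R i) × (∀ {R′} → R′ ⊆ R → Balanced R′ (bx + x i) (by + y i))
    extend {bx = bx} {by} bal i₀ i₀∈R with ≤-total bx by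
    ... | inj₁ bx≤by = extend-lighter x≤s bx≤by bal i₀ i₀∈R
    ... | inj₂ by≤bx =
      map₂ (map₂ (λ bal′ R′⊆R → swap (bal′ R′⊆R)))
           (Sym.extend-lighter y≤s by≤bx (swap bal) i₀ i₀∈R)

    record Filled (M : Mask n) (r : ℕ) : Set where
      constructor filled
      field
        bin    : Mask n
        bin⊆M  : bin ⊆ M
        fits   : Fits bin
        leaves : (∀ i → ¬ T ((M ∖ bin) i)) ⊎ (∑⟨ M ∖ bin ⟩ x < D * r × ∑⟨ M ∖ bin ⟩ y < D * r)

    module _ (M : Mask n) (r : ℕ) (hx : ∑⟨ M ⟩ x < D * suc r) (hy : ∑⟨ M ⟩ y < D * suc r) where

      split-budget : ∀ {B} → B ⊆ M → ∀ f → ∑⟨ M ⟩ f < D * suc r →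
                     ∑⟨ B ⟩ f + ∑⟨ M ∖ B ⟩ f < D * suc r
      split-budget B⊆M f = subst (_< D * suc r) (∑-split B⊆M f)

      closing : ∀ {B} → B ⊆ M → Balanced (M ∖ B) (∑⟨ B ⟩ x) (∑⟨ B ⟩ y) →
                D + s ≤ ∑⟨ B ⟩ x ⊎ D + s ≤ ∑⟨ B ⟩ y →
                ∑⟨ M ∖ B ⟩ x < D * r × ∑⟨ M ∖ B ⟩ y < D * r
      closing B⊆M bal (inj₁ full) =
        closing-drains bal full (split-budget B⊆M x hx) (split-budget B⊆M y hy)
      closing B⊆M bal (inj₂ full) =
        swap (Sym.closing-drains (swap bal) full (split-budget B⊆M y hy) (split-budget B⊆M x hx))

      fill-from : ∀ B → Acc _<_ ∣ M ∖ B ∣ → B ⊆ M → Fits B →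
                  Balanced (M ∖ B) (∑⟨ B ⟩ x) (∑⟨ B ⟩ y) → Filled M r
      fill-from B (acc smaller) B⊆M fitsB bal with any? (λ i → T? ((M ∖ B) i))
      ... | no nothing-left = filled B B⊆M fitsB (inj₁ (λ i i∈ → nothing-left (i , i∈)))
      ... | yes (i₀ , i₀∈R) with (D + s ≤? ∑⟨ B ⟩ x) ⊎-dec (D + s ≤? ∑⟨ B ⟩ y)
      ...   | yes full = filled B B⊆M fitsB (inj₂ (closing B⊆M bal full))
      ...   | no room with extend bal i₀ i₀∈R
      ...     | i , i∈R , bal-extended =
        fill-from (insert i B) (smaller shrinks) (insert-⊆ i B i∈M B⊆M)
                  (room-for x x≤s (room ∘ inj₁) , room-for y y≤s (room ∘ inj₂)) bal′
        where
        i∈M : T (M i)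
        i∈M = proj₁ (∈∖ M B i∈R)
        i∉B : ¬ T (B i)
        i∉B = proj₂ (∈∖ M B i∈R)
        shrinks : ∣ M ∖ insert i B ∣ < ∣ M ∖ B ∣
        shrinks = ≤-reflexive (sym (∑-∖-insert i B B⊆M i∈M i∉B (λ _ → 1)))
        room-for : ∀ f → (∀ j → f j ≤ s) → ¬ D + s ≤ ∑⟨ B ⟩ f → ∑⟨ insert i B ⟩ f ≤ C
        room-for f f≤s not-full =
          subst (_≤ C) (sym (∑-insert i B i∉B f)) (+-mono-≤ (<⇒≤ (≰⇒> not-full)) (f≤s i))
        bal′ : Balanced (M ∖ insert i B) (∑⟨ insert i B ⟩ x) (∑⟨ insert i B ⟩ y)
        bal′ = subst₂ (Balanced _) (sym (∑-insert i B i∉B x)) (sym (∑-insert i B i∉B y))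
                      (bal-extended (∖-insert-⊆ i M B))

      fill : Filled M r
      fill = fill-from ∅ (<-wellFounded _) (λ ()) (empty-fits x , empty-fits y)
                       ((λ _ → balanced y x) , (λ _ → balanced x y))
        where
        empty-fits : ∀ f → ∑⟨ ∅ ⟩ f ≤ C
        empty-fits f = subst (_≤ C) (sym (∑-∅ f)) z≤n
        balanced : ∀ f g → ∑⟨ ∅ ⟩ f ≤ ∑⟨ ∅ ⟩ g + s
        balanced f g = subst₂ (λ u v → u ≤ v + s) (sym (∑-∅ f)) (sym (∑-∅ g)) z≤n

    pack : ∀ t M → ∑⟨ M ⟩ x < D * t → ∑⟨ M ⟩ y < D * t →
           Σ[ σ ∈ (Fin n → Fin t) ] ∀ k → Fits (M ∩ preimage σ k)
    pack zero    M hx _  = ⊥-elim (n≮0 (subst (∑⟨ M ⟩ x <_) (*-zeroʳ D) hx))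
    pack (suc r) M hx hy with fill M r hx hy
    ... | filled B B⊆M fitsB (inj₁ M∖B-empty) =
      (λ _ → zero) , λ k → fits-⊆ (λ i∈ → ∖-empty⇒⊆ M B M∖B-empty (∩-⊆ˡ M _ i∈)) fitsB
    ... | filled B B⊆M fitsB (inj₂ (rx , ry)) with pack r (M ∖ B) rx ry
    ...   | σ′ , fits′ = σ , fits
      where
      σ : Fin n → Fin (suc r)
      σ i = if B i then zero else suc (σ′ i)
      first⊆B : M ∩ preimage σ zero ⊆ B
      first⊆B {i} with B i | M i
      ... | true  | _     = _
      ... | false | true  = λ ()
      ... | false | false = λ ()
      later⊆rest : ∀ k → M ∩ preimage σ (suc k) ⊆ (M ∖ B) ∩ preimage σ′ k
      later⊆rest k {i} with B i | M i
      ... | true  | true  = λ ()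
      ... | true  | false = λ ()
      ... | false | true  = λ i∈ → i∈
      ... | false | false = λ ()
      fits : ∀ k → Fits (M ∩ preimage σ k)
      fits zero    = fits-⊆ first⊆B fitsB
      fits (suc k) = fits-⊆ (later⊆rest k) (fits′ k)

  u+10st<wt⇒9s≤w : ∀ {u s w t} → u + 10 * s * t < w * t → 9 * s ≤ w
  u+10st<wt⇒9s≤w {u} {s} {w} {t} h =
    ≤-trans (*-monoˡ-≤ s (n≤1+n 9))
            (<⇒≤ (*-cancelʳ-< t (10 * s) w (≤-<-trans (m≤n+m (10 * s * t) u) h)))

  u+10st<wt⇒u<[w∸9s]t : ∀ {u s w t} → u + 10 * s * t < w * t → u < (w ∸ 9 * s) * t
  u+10st<wt⇒u<[w∸9s]t {u} {s} {w} {t} h = subst (u <_) (sym (*-distribʳ-∸ t w (9 * s)))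
    (m+n≤o⇒m≤o∸n (suc u) (≤-trans (s≤s (+-monoʳ-≤ u 9st≤10st)) h))
    where
    9st≤10st : 9 * s * t ≤ 10 * s * t
    9st≤10st = *-monoˡ-≤ t (*-monoˡ-≤ s (n≤1+n 9))

  v≤[w∸9s]+s+s⇒v+7s≤w : ∀ {v s w} → 9 * s ≤ w → v ≤ (w ∸ 9 * s) + s + s → v + 7 * s ≤ w
  v≤[w∸9s]+s+s⇒v+7s≤w {v} {s} {w} 9s≤w v≤ = begin
    v + 7 * s                    ≤⟨ +-monoˡ-≤ (7 * s) v≤ ⟩
    (w ∸ 9 * s) + s + s + 7 * s  ≡⟨ collect (w ∸ 9 * s) s ⟩
    (w ∸ 9 * s) + 9 * s          ≡⟨ m∸n+n≡m 9s≤w ⟩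
    w                            ∎
    where
    open ≤-Reasoning
    collect : ∀ X s → X + s + s + 7 * s ≡ X + 9 * s
    collect = solve-∀

  bin-partition : ∀ {n} (b a m t : ℕ) (p q : Fin n → ℕ) →
                  (∀ i → b * (p i + q i) ≤ a * m) →
                  b * sumFin p + 10 * (a * m) * t < b * m * t →
                  b * sumFin q + 10 * (a * m) * t < b * m * t →
                  Σ[ π ∈ (Fin n → Fin t) ] ∀ k →
                    b * partSum π k p + 7 * (a * m) ≤ b * m × b * partSum π k q + 7 * (a * m) ≤ b * m
  bin-partition {n} b a m t p q small-items p-total q-total =
    π , λ k → bound k p (proj₁ (π-fits k)) , bound k q (proj₂ (π-fits k))
    where
    s D : ℕ
    s = a * m
    D = b * m ∸ 9 * s
    x≤s : ∀ i → b * p i ≤ s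
    x≤s i = ≤-trans (*-monoʳ-≤ b (m≤m+n (p i) (q i))) (small-items i)
    y≤s : ∀ i → b * q i ≤ s
    y≤s i = ≤-trans (*-monoʳ-≤ b (m≤n+m (q i) (p i))) (small-items i)
    open Greedy s D (λ i → b * p i) (λ i → b * q i) x≤s y≤s
    everything : Mask n
    everything _ = true
    below : ∀ f → b * sumFin f + 10 * s * t < b * m * t → ∑⟨ everything ⟩ (λ i → b * f i) < D * t
    below f total =
      subst (_< D * t) (sym (sumFin-* b f)) (u+10st<wt⇒u<[w∸9s]t {s = s} {w = b * m} total)
    packing : Σ[ π ∈ (Fin n → Fin t) ] ∀ k → Fits (everything ∩ preimage π k)
    packing = pack t everything (below p p-total) (below q q-total)
    π : Fin n → Fin t
    π = proj₁ packing
    π-fits : ∀ k → Fits (preimage π k)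
    π-fits = proj₂ packing
    bound : ∀ k f → ∑⟨ preimage π k ⟩ (λ i → b * f i) ≤ C → b * partSum π k f + 7 * s ≤ b * m
    bound k f fits = v≤[w∸9s]+s+s⇒v+7s≤w {s = s} (u+10st<wt⇒9s≤w {s = s} {w = b * m} p-total)
      (subst (_≤ C) (trans (∑-* (preimage π k) b f) (cong (b *_) (sym (partSum-∑ π k f)))) fits)

module NatEmbedding where

  open import Data.Nat as ℕ using (ℕ; zero; suc)
  import Data.Nat.Properties as ℕ
  import Data.Nat.Coprimality as Coprime
  import Data.Integer as ℤ
  import Data.Integer.Properties as ℤ
  open import Data.Rational
  open import Data.Rational.Properties
  import Data.Rational.Unnormalised as ℚᵘ
  import Data.Rational.Unnormalised.Properties as ℚᵘ
  open import Data.Rational.Solver using (module +-*-Solver)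
  open import Relation.Binary.PropositionalEquality

  private
    coprime-1 : ∀ n → Coprime.Coprime n 1
    coprime-1 n = Coprime.sym (Coprime.1-coprimeTo n)

  ℕ→ℚ-mkℚ : ∀ n → ℕ→ℚ n ≡ mkℚ (ℤ.+ n) 0 (coprime-1 n)
  ℕ→ℚ-mkℚ n = normalize-coprime _

  ℕ→ℚ-suc : ∀ n → ℕ→ℚ (suc n) ≡ 1ℚ + ℕ→ℚ n
  ℕ→ℚ-suc n rewrite ℕ→ℚ-mkℚ n | ℕ→ℚ-mkℚ (suc n) =
    toℚᵘ-injective (ℚᵘ.≃-sym (ℚᵘ.≃-trans (toℚᵘ-homo-+ 1ℚ (mkℚ (ℤ.+ n) 0 (coprime-1 n))) (ℚᵘ.*≡* (begin
      (ℤ.+ 1 ℤ.+ ℤ.+ n ℤ.* ℤ.+ 1) ℤ.* ℤ.+ 1  ≡⟨ ℤ.*-identityʳ _ ⟩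
      ℤ.+ 1 ℤ.+ ℤ.+ n ℤ.* ℤ.+ 1              ≡⟨ cong (ℤ._+_ (ℤ.+ 1)) (ℤ.*-identityʳ (ℤ.+ n)) ⟩
      ℤ.+ suc n                              ≡⟨ ℤ.*-identityʳ (ℤ.+ suc n) ⟨
      ℤ.+ suc n ℤ.* ℤ.+ 1                    ∎))))
    where open ≡-Reasoning

  ℕ→ℚ-+ : ∀ m n → ℕ→ℚ (m ℕ.+ n) ≡ ℕ→ℚ m + ℕ→ℚ n
  ℕ→ℚ-+ zero    n = sym (+-identityˡ (ℕ→ℚ n))
  ℕ→ℚ-+ (suc m) n = begin
    ℕ→ℚ (suc (m ℕ.+ n))   ≡⟨ ℕ→ℚ-suc (m ℕ.+ n) ⟩
    1ℚ + ℕ→ℚ (m ℕ.+ n)    ≡⟨ cong (1ℚ +_) (ℕ→ℚ-+ m n) ⟩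
    1ℚ + (ℕ→ℚ m + ℕ→ℚ n)  ≡⟨ +-assoc 1ℚ (ℕ→ℚ m) (ℕ→ℚ n) ⟨
    1ℚ + ℕ→ℚ m + ℕ→ℚ n    ≡⟨ cong (_+ ℕ→ℚ n) (ℕ→ℚ-suc m) ⟨
    ℕ→ℚ (suc m) + ℕ→ℚ n   ∎
    where open ≡-Reasoning

  ℕ→ℚ-* : ∀ m n → ℕ→ℚ (m ℕ.* n) ≡ ℕ→ℚ m * ℕ→ℚ n
  ℕ→ℚ-* zero    n = sym (*-zeroˡ (ℕ→ℚ n))
  ℕ→ℚ-* (suc m) n = begin
    ℕ→ℚ (n ℕ.+ m ℕ.* n)         ≡⟨ ℕ→ℚ-+ n (m ℕ.* n) ⟩
    ℕ→ℚ n + ℕ→ℚ (m ℕ.* n)       ≡⟨ cong₂ _+_ (sym (*-identityˡ (ℕ→ℚ n))) (ℕ→ℚ-* m n) ⟩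
    1ℚ * ℕ→ℚ n + ℕ→ℚ m * ℕ→ℚ n  ≡⟨ *-distribʳ-+ (ℕ→ℚ n) 1ℚ (ℕ→ℚ m) ⟨
    (1ℚ + ℕ→ℚ m) * ℕ→ℚ n        ≡⟨ cong (_* ℕ→ℚ n) (ℕ→ℚ-suc m) ⟨
    ℕ→ℚ (suc m) * ℕ→ℚ n         ∎
    where open ≡-Reasoning

  ℕ→ℚ-mono-≤ : ∀ {m n} → m ℕ.≤ n → ℕ→ℚ m ≤ ℕ→ℚ n
  ℕ→ℚ-mono-≤ {m} {n} m≤n rewrite ℕ→ℚ-mkℚ m | ℕ→ℚ-mkℚ n =
    *≤* (subst₂ ℤ._≤_ (sym (ℤ.*-identityʳ (ℤ.+ m))) (sym (ℤ.*-identityʳ (ℤ.+ n))) (ℤ.+≤+ m≤n))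

  ℕ→ℚ-mono-< : ∀ {m n} → m ℕ.< n → ℕ→ℚ m < ℕ→ℚ n
  ℕ→ℚ-mono-< {m} {n} m<n rewrite ℕ→ℚ-mkℚ m | ℕ→ℚ-mkℚ n =
    *<* (subst₂ ℤ._<_ (sym (ℤ.*-identityʳ (ℤ.+ m))) (sym (ℤ.*-identityʳ (ℤ.+ n))) (ℤ.+<+ m<n))

  ℕ→ℚ-cancel-≤ : ∀ {m n} → ℕ→ℚ m ≤ ℕ→ℚ n → m ℕ.≤ n
  ℕ→ℚ-cancel-≤ {m} {n} ιm≤ιn rewrite ℕ→ℚ-mkℚ m | ℕ→ℚ-mkℚ n with ιm≤ιn
  ... | *≤* m≤n =
    ℤ.drop‿+≤+ (subst₂ ℤ._≤_ (ℤ.*-identityʳ (ℤ.+ m)) (ℤ.*-identityʳ (ℤ.+ n)) m≤n)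

  ℕ→ℚ-cancel-< : ∀ {m n} → ℕ→ℚ m < ℕ→ℚ n → m ℕ.< n
  ℕ→ℚ-cancel-< {m} {n} ιm<ιn rewrite ℕ→ℚ-mkℚ m | ℕ→ℚ-mkℚ n with ιm<ιn
  ... | *<* m<n =
    ℤ.drop‿+<+ (subst₂ ℤ._<_ (ℤ.*-identityʳ (ℤ.+ m)) (ℤ.*-identityʳ (ℤ.+ n)) m<n)

  +-cancelʳ-≤ : ∀ r {p q} → p + r ≤ q + r → p ≤ q
  +-cancelʳ-≤ r {p} {q} p+r≤q+r = begin
    p          ≡⟨ solve 2 (λ p r → p := p :+ r :- r) refl p r ⟩
    p + r - r  ≤⟨ +-monoˡ-≤ (- r) p+r≤q+r ⟩
    q + r - r  ≡⟨ solve 2 (λ q r → q :+ r :- r := q) refl q r ⟩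
    q          ∎
    where
    open ≤-Reasoning
    open +-*-Solver

  denominator-clears : ∀ a d .(c : Coprime.Coprime a (suc d)) →
                       ℕ→ℚ (suc d) * mkℚ (ℤ.+ a) d c ≡ ℕ→ℚ a
  denominator-clears a d c rewrite ℕ→ℚ-mkℚ (suc d) | ℕ→ℚ-mkℚ a =
    toℚᵘ-injective (ℚᵘ.≃-trans (toℚᵘ-homo-* (mkℚ (ℤ.+ suc d) 0 (coprime-1 (suc d))) (mkℚ (ℤ.+ a) d c))
                               (ℚᵘ.*≡* (begin
      ℤ.+ suc d ℤ.* ℤ.+ a ℤ.* ℤ.+ 1  ≡⟨ ℤ.*-identityʳ _ ⟩
      ℤ.+ suc d ℤ.* ℤ.+ a            ≡⟨ ℤ.*-comm (ℤ.+ suc d) (ℤ.+ a) ⟩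
      ℤ.+ a ℤ.* ℤ.+ suc d            ≡⟨ cong (λ k → ℤ.+ a ℤ.* ℤ.+ suc k) (ℕ.+-identityʳ d) ⟨
      ℤ.+ a ℤ.* ℤ.+ suc (d ℕ.+ 0)    ∎)))
    where open ≡-Reasoning

  module Scaling (α : ℚ) (a d : ℕ) (bα≡a : ℕ→ℚ (suc d) * α ≡ ℕ→ℚ a) where

    private
      b : ℕ
      b = suc d
      β : ℚ
      β = ℕ→ℚ b
      instance
        β-pos : Positive β
        β-pos = positive (ℕ→ℚ-mono-< (ℕ.z<s {d}))
        β-nonNeg : NonNegative β
        β-nonNeg = pos⇒nonNeg β
      ℕ→ℚ-b*+ : ∀ P K → ℕ→ℚ (b ℕ.* P ℕ.+ K) ≡ β * ℕ→ℚ P + ℕ→ℚ K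
      ℕ→ℚ-b*+ P K = trans (ℕ→ℚ-+ (b ℕ.* P) K) (cong (_+ ℕ→ℚ K) (ℕ→ℚ-* b P))

    scale-≤ : ∀ k m → ℕ→ℚ k ≤ α * ℕ→ℚ m → b ℕ.* k ℕ.≤ a ℕ.* m
    scale-≤ k m k≤αm = ℕ→ℚ-cancel-≤ (begin
      ℕ→ℚ (b ℕ.* k)    ≡⟨ ℕ→ℚ-* b k ⟩
      β * ℕ→ℚ k        ≤⟨ *-monoˡ-≤-nonNeg β k≤αm ⟩
      β * (α * ℕ→ℚ m)  ≡⟨ *-assoc β α (ℕ→ℚ m) ⟨
      β * α * ℕ→ℚ m    ≡⟨ cong (_* ℕ→ℚ m) bα≡a ⟩
      ℕ→ℚ a * ℕ→ℚ m    ≡⟨ ℕ→ℚ-* a m ⟨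
      ℕ→ℚ (a ℕ.* m)    ∎)
      where open ≤-Reasoning

    cleared : ∀ k M → β * ((1ℚ - ℕ→ℚ k * α) * ℕ→ℚ M) + ℕ→ℚ (k ℕ.* (a ℕ.* M)) ≡ ℕ→ℚ (b ℕ.* M)
    cleared k M = begin
      β * ((1ℚ - K * α) * X) + ℕ→ℚ (k ℕ.* (a ℕ.* M))  ≡⟨ cong (β * ((1ℚ - K * α) * X) +_) kaM ⟩
      β * ((1ℚ - K * α) * X) + K * (β * α * X)       ≡⟨ ring β K α X ⟩
      β * X                                          ≡⟨ ℕ→ℚ-* b M ⟨
      ℕ→ℚ (b ℕ.* M)                                  ∎
      where
      open ≡-Reasoning
      open +-*-Solver
      K X : ℚ
      K = ℕ→ℚ k
      X = ℕ→ℚ M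
      kaM : ℕ→ℚ (k ℕ.* (a ℕ.* M)) ≡ K * (β * α * X)
      kaM = trans (ℕ→ℚ-* k (a ℕ.* M)) (cong (K *_) (trans (ℕ→ℚ-* a M) (cong (_* X) (sym bα≡a))))
      ring : ∀ β K α X → β * ((1ℚ - K * α) * X) + K * (β * α * X) ≡ β * X
      ring = solve 4 (λ β K α X → β :* ((con 1ℚ :- K :* α) :* X) :+ K :* (β :* α :* X) := β :* X) refl

    scale-< : ∀ k P m t → ℕ→ℚ P < (1ℚ - ℕ→ℚ k * α) * ℕ→ℚ m * ℕ→ℚ t →
              b ℕ.* P ℕ.+ k ℕ.* (a ℕ.* m) ℕ.* t ℕ.< b ℕ.* m ℕ.* t
    scale-< k P m t P<[1-kα]mt =
      subst₂ ℕ._<_ (cong (b ℕ.* P ℕ.+_) (sym (reassoc k a m t))) (sym (ℕ.*-assoc b m t))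
        (ℕ→ℚ-cancel-< (begin-strict
          ℕ→ℚ (b ℕ.* P ℕ.+ kaM)                       ≡⟨ ℕ→ℚ-b*+ P kaM ⟩
          β * ℕ→ℚ P + ℕ→ℚ kaM                         <⟨ +-monoˡ-< (ℕ→ℚ kaM) (*-monoʳ-<-pos β P<[1-kα]mt) ⟩
          β * ((1ℚ - K * α) * ℕ→ℚ m * ℕ→ℚ t) + ℕ→ℚ kaM ≡⟨ cong (λ u → β * u + ℕ→ℚ kaM) [mt] ⟩
          β * ((1ℚ - K * α) * ℕ→ℚ (m ℕ.* t)) + ℕ→ℚ kaM ≡⟨ cleared k (m ℕ.* t) ⟩
          ℕ→ℚ (b ℕ.* (m ℕ.* t))                       ∎))
      where
      open ≤-Reasoning
      K : ℚ
      K = ℕ→ℚ k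
      kaM : ℕ
      kaM = k ℕ.* (a ℕ.* (m ℕ.* t))
      reassoc : ∀ k a m t → k ℕ.* (a ℕ.* m) ℕ.* t ≡ k ℕ.* (a ℕ.* (m ℕ.* t))
      reassoc k a m t = trans (ℕ.*-assoc k (a ℕ.* m) t) (cong (k ℕ.*_) (ℕ.*-assoc a m t))
      [mt] : (1ℚ - K * α) * ℕ→ℚ m * ℕ→ℚ t ≡ (1ℚ - K * α) * ℕ→ℚ (m ℕ.* t)
      [mt] = trans (*-assoc (1ℚ - K * α) (ℕ→ℚ m) (ℕ→ℚ t)) (cong ((1ℚ - K * α) *_) (sym (ℕ→ℚ-* m t)))

    unscale-≤ : ∀ k S m → b ℕ.* S ℕ.+ k ℕ.* (a ℕ.* m) ℕ.≤ b ℕ.* m →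
                ℕ→ℚ S ≤ (1ℚ - ℕ→ℚ k * α) * ℕ→ℚ m
    unscale-≤ k S m bS+kam≤bm = *-cancelˡ-≤-pos β (+-cancelʳ-≤ (ℕ→ℚ kam) (begin
      β * ℕ→ℚ S + ℕ→ℚ kam                       ≡⟨ ℕ→ℚ-b*+ S kam ⟨
      ℕ→ℚ (b ℕ.* S ℕ.+ kam)                     ≤⟨ ℕ→ℚ-mono-≤ bS+kam≤bm ⟩
      ℕ→ℚ (b ℕ.* m)                             ≡⟨ cleared k m ⟨
      β * ((1ℚ - ℕ→ℚ k * α) * ℕ→ℚ m) + ℕ→ℚ kam  ∎))
      where
      open ≤-Reasoning
      kam : ℕ
      kam = k ℕ.* (a ℕ.* m)

open import Data.Rational using (ℚ; 0ℚ; 1ℚ; _+_; _-_; _*_; _≤_; _<_; mkℚ; *<*)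
import Data.Nat as ℕ
open import Data.Nat using (suc)
import Data.Integer as ℤ
open import Data.Product using (_,_; proj₁; proj₂)
open BinPacking using (bin-partition)
open NatEmbedding using (module Scaling; denominator-clears)

lemma3 : (m t : ℕ) (α : ℚ) → 0ℚ < α →
         (n : ℕ) (p q : Fin n → ℕ) →
         (1ℚ - α) * ℕ→ℚ (sumFin p) ≤ ℕ→ℚ (sumFin q) →
         ℕ→ℚ (sumFin q) ≤ (1ℚ + α) * ℕ→ℚ (sumFin p) →
         (∀ i → ℕ→ℚ (p i Data.Nat.+ q i) ≤ α * ℕ→ℚ m) →
         ℕ→ℚ (sumFin p) < (1ℚ - ℕ→ℚ 10 * α) * ℕ→ℚ m * ℕ→ℚ t →
         ℕ→ℚ (sumFin q) < (1ℚ - ℕ→ℚ 10 * α) * ℕ→ℚ m * ℕ→ℚ t →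
         Σ (Fin n → Fin t) λ π → ∀ j →
           (ℕ→ℚ (partSum π j p) ≤ (1ℚ - ℕ→ℚ 7 * α) * ℕ→ℚ m) ×
           (ℕ→ℚ (partSum π j q) ≤ (1ℚ - ℕ→ℚ 7 * α) * ℕ→ℚ m)
lemma3 m t (mkℚ ℤ.-[1+ _ ] _ _) (*<* ()) n p q _ _ _ _ _
lemma3 m t α@(mkℚ (ℤ.+ a) d c) _ n p q _ _ small-items p-total q-total =
  let π , bins = partition in
  π , λ k → unscale-≤ 7 (partSum π k p) m (proj₁ (bins k))
          , unscale-≤ 7 (partSum π k q) m (proj₂ (bins k))
  where
  open Scaling α a d (denominator-clears a d c)
  partition : Σ (Fin n → Fin t) λ π → ∀ k →
                (suc d ℕ.* partSum π k p ℕ.+ 7 ℕ.* (a ℕ.* m) ℕ.≤ suc d ℕ.* m) ×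
                (suc d ℕ.* partSum π k q ℕ.+ 7 ℕ.* (a ℕ.* m) ℕ.≤ suc d ℕ.* m)
  partition = bin-partition (suc d) a m t p q
                (λ i → scale-≤ (p i ℕ.+ q i) m (small-items i))
                (scale-< 10 (sumFin p) m t p-total) (scale-< 10 (sumFin q) m t q-total)
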